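{- Let $G=(V,E)$ be a simple graph and $\nu\colon V\to[k]$ a coloring of $G$ such that for every $u,v\in V$ with $\nu(u)=\nu(v)$, either $\mathcal{N}(v)\subseteq\mathcal{N}(u)$ or $\mathcal{N}(u)\subseteq\mathcal{N}(v)$. Then $\nu$ is a $k$-linear coloring of the neighborhood complex $\mathcal{N}(G)$.
   Context: A coloring of $G$ is a surjective map $\nu\colon V\to[k]=\{1,\dots,k\}$ with $\nu(x)\neq\nu(y)$ whenever $(x,y)\in E$. $\mathcal{N}(v)$ is the set of neighbors of $v$. $\mathcal{N}(G)$ is the simplicial complex on $V$ whose simplices are the subsets of $V$ having a common neighbor. For a simplicial complex with vertex set $V$ and $\kappa\colon V\to[k]$, $S_\kappa(t)=|\{w\in S:\kappa(w)=t\}|$; a $k$-linear coloring is a surjective $\kappa$ with $\sum_t\min(F_\kappa(t),F'_\kappa(t))=|F\cap F'|$ for all facets (maximal faces) $F,F'$. -}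

module Defs where

open import Data.Nat using (ℕ; _⊓_)
open import Data.Bool using (Bool; true; false)
open import Data.Fin using (Fin; _≟_)
open import Data.Fin.Subset using (Subset; _⊆_; _∩_; ∣_∣)
open import Data.Vec using (tabulate)
open import Data.List using (map; allFin)
open import Data.Nat.ListAction using (sum)
open import Data.Product using (Σ; ∃; _×_)
open import Relation.Binary.PropositionalEquality using (_≡_; _≢_)
open import Relation.Nullary.Decidable using (⌊_⌋)

record SimpleGraph (n : ℕ) : Set where
  field
    adj   : Fin n → Fin n → Bool
    sym   : ∀ x y → adj x y ≡ adj y x
    irrefl : ∀ x → adj x x ≡ false
open SimpleGraph public

Nbhd : ∀ {n} → SimpleGraph n → Fin n → Subset n
Nbhd G v = tabulate (adj G v)

IsColoring : ∀ {n k} → SimpleGraph n → (Fin n → Fin k) → Set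
IsColoring {n} {k} G ν =
  (∀ (t : Fin k) → ∃ λ (v : Fin n) → ν v ≡ t)
  × (∀ x y → adj G x y ≡ true → ν x ≢ ν y)

IsSimplexN : ∀ {n} → SimpleGraph n → Subset n → Set
IsSimplexN {n} G S = ∃ λ (v : Fin n) → S ⊆ Nbhd G v

IsFacetN : ∀ {n} → SimpleGraph n → Subset n → Set
IsFacetN G F = IsSimplexN G F × (∀ S → IsSimplexN G S → F ⊆ S → S ⊆ F)

colorClass : ∀ {n k} → (Fin n → Fin k) → Fin k → Subset n
colorClass κ t = tabulate (λ w → ⌊ κ w ≟ t ⌋)

count : ∀ {n k} → (Fin n → Fin k) → Subset n → Fin k → ℕ
count κ S t = ∣ S ∩ colorClass κ t ∣

IsKLinearColoringN : ∀ {n} (k : ℕ) → SimpleGraph n → (Fin n → Fin k) → Set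
IsKLinearColoringN {n} k G κ =
  (∀ (t : Fin k) → ∃ λ (v : Fin n) → κ v ≡ t)
  × (∀ F F' → IsFacetN G F → IsFacetN G F' →
       sum (map (λ t → count κ F t ⊓ count κ F' t) (allFin k)) ≡ ∣ F ∩ F' ∣)

-- A facet of 𝒩(G) is a full neighbourhood 𝒩(v).  For facets 𝒩(v), 𝒩(v') and a
-- colour t, the sets 𝒩(v) ∩ ν⁻¹(t) and 𝒩(v') ∩ ν⁻¹(t) are comparable: if
-- a ∈ 𝒩(v) ∖ 𝒩(v') and b ∈ 𝒩(v') ∖ 𝒩(v) had the same colour, then 𝒩(b) ⊆ 𝒩(a)
-- would put a into 𝒩(v') (as v' ∈ 𝒩(b)), and 𝒩(a) ⊆ 𝒩(b) would put b into 𝒩(v).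
-- For comparable sets the smaller size is the size of the intersection, hence
-- Σₜ min(F(t), F'(t)) = Σₜ |(F ∩ F') ∩ ν⁻¹(t)| = |F ∩ F'|.
module Submission where

open import Defs
open import Data.Nat.Properties using (+-0-commutativeMonoid; m≤n⇒m⊓n≡m; ⊓-comm)
open import Algebra.Properties.CommutativeMonoid.Sum +-0-commutativeMonoid
  using (sum-syntax; ∑-distrib-+; sum-replicate-zero; sum-cong-≗)
import Algebra.Solver.IdempotentCommutativeMonoid as ∩-Solver
open import Data.Bool using (Bool; true; false; if_then_else_)
open import Data.Bool.Properties using (T-≡)
open import Data.Fin using (Fin; zero; suc; _≟_)
open import Data.Fin.Properties using (any?)
open import Data.Fin.Subset using (Subset; _⊆_; _∩_; ∣_∣; _∈_)
open import Data.Fin.Subset.Properties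
  using (p⊆q⇒∣p∣≤∣q∣; ⊆-antisym; p∩q⊆p; x∈p∩q⁺; x∈p∩q⁻; _∈?_; ∩-comm; ∩-idempotentCommutativeMonoid)
open import Data.List using (map; allFin; tabulate)
open import Data.List.Properties using (map-tabulate)
open import Data.Nat using (ℕ; zero; suc; _+_; _⊓_)
open import Data.Nat.ListAction using (sum)
open import Data.Product using (∃; _,_)
open import Data.Sum using (_⊎_; inj₁; inj₂; [_,_])
open import Data.Vec using (_∷_; [])
import Data.Vec as Vec
open import Data.Vec.Properties using (lookup∘tabulate; []=⇒lookup; lookup⇒[]=)
open import Function using (_∘_; id; Equivalence)
open import Relation.Nullary using (yes; no; ¬?; contradiction)
open import Relation.Nullary.Decidable using (⌊_⌋; _×-dec_; toWitness; decidable-stable)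
open import Relation.Binary.PropositionalEquality as ≡ using (_≡_; refl; trans; cong; cong₂)
open ≡.≡-Reasoning

sum-tabulate : ∀ {k} (f : Fin k → ℕ) → sum (tabulate f) ≡ ∑[ t < k ] f t
sum-tabulate {zero}  f = refl
sum-tabulate {suc k} f = cong (f zero +_) (sum-tabulate (f ∘ suc))

sum-map-allFin : ∀ k (f : Fin k → ℕ) → sum (map f (allFin k)) ≡ ∑[ t < k ] f t
sum-map-allFin k f = trans (cong sum (map-tabulate id f)) (sum-tabulate f)

boolToℕ : Bool → ℕ
boolToℕ b = if b then 1 else 0

∑-boolToℕ-≟ : ∀ {k} (i : Fin k) → ∑[ t < k ] boolToℕ ⌊ i ≟ t ⌋ ≡ 1
∑-boolToℕ-≟ {suc k} zero    = cong suc (sum-replicate-zero k)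
∑-boolToℕ-≟ {suc k} (suc i) = trans (sum-cong-≗ (cong boolToℕ ∘ ⌊suc≟suc⌋ i)) (∑-boolToℕ-≟ i)
  where
  ⌊suc≟suc⌋ : ∀ i t → ⌊ suc i ≟ suc t ⌋ ≡ ⌊ i ≟ t ⌋
  ⌊suc≟suc⌋ i t with i ≟ t
  ... | yes _ = refl
  ... | no  _ = refl

∣x∷p∣≡boolToℕx+∣p∣ : ∀ {n} x (p : Subset n) → ∣ x ∷ p ∣ ≡ boolToℕ x + ∣ p ∣
∣x∷p∣≡boolToℕx+∣p∣ true  p = refl
∣x∷p∣≡boolToℕx+∣p∣ false p = refl

∑-count≡∣p∣ : ∀ {n k} (κ : Fin n → Fin k) (p : Subset n) → ∑[ t < k ] count κ p t ≡ ∣ p ∣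
∑-count≡∣p∣ {k = k} κ []          = sum-replicate-zero k
∑-count≡∣p∣         κ (false ∷ p) = ∑-count≡∣p∣ (κ ∘ suc) p
∑-count≡∣p∣ {k = k} κ (true ∷ p)  = begin
  ∑[ t < k ] count κ (true ∷ p) t
    ≡⟨ sum-cong-≗ (λ t → ∣x∷p∣≡boolToℕx+∣p∣ ⌊ κ zero ≟ t ⌋ (p ∩ colorClass (κ ∘ suc) t)) ⟩
  ∑[ t < k ] (boolToℕ ⌊ κ zero ≟ t ⌋ + count (κ ∘ suc) p t)
    ≡⟨ ∑-distrib-+ (boolToℕ ∘ ⌊_⌋ ∘ (κ zero ≟_)) (count (κ ∘ suc) p) ⟩
  ∑[ t < k ] boolToℕ ⌊ κ zero ≟ t ⌋ + ∑[ t < k ] count (κ ∘ suc) p t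
    ≡⟨ cong₂ _+_ (∑-boolToℕ-≟ (κ zero)) (∑-count≡∣p∣ (κ ∘ suc) p) ⟩
  suc ∣ p ∣
    ∎

Comparable : ∀ {n} → Subset n → Subset n → Set
Comparable p q = p ⊆ q ⊎ q ⊆ p

no-crossing⇒comparable : ∀ {n} {p q : Subset n} →
  (∀ {x y} → x ∈ p → y ∈ q → x ∈ q ⊎ y ∈ p) → Comparable p q
no-crossing⇒comparable {p = p} {q} no-crossing with any? (λ x → x ∈? p ×-dec ¬? (x ∈? q))
... | yes (x , x∈p , x∉q) = inj₂ λ y∈q → [ (λ x∈q → contradiction x∈q x∉q) , id ] (no-crossing x∈p y∈q)
... | no ∄x∈p∖q           = inj₁ λ {x} x∈p → decidable-stable (x ∈? q) (λ x∉q → ∄x∈p∖q (x , x∈p , x∉q))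

p⊆q⇒p∩q≡p : ∀ {n} {p q : Subset n} → p ⊆ q → p ∩ q ≡ p
p⊆q⇒p∩q≡p {p = p} {q} p⊆q = ⊆-antisym (p∩q⊆p p q) (λ x∈p → x∈p∩q⁺ (x∈p , p⊆q x∈p))

comparable⇒∣p∣⊓∣q∣≡∣p∩q∣ : ∀ {n} {p q : Subset n} → Comparable p q → ∣ p ∣ ⊓ ∣ q ∣ ≡ ∣ p ∩ q ∣
comparable⇒∣p∣⊓∣q∣≡∣p∩q∣ (inj₁ p⊆q) =
  trans (m≤n⇒m⊓n≡m (p⊆q⇒∣p∣≤∣q∣ p⊆q)) (cong ∣_∣ (≡.sym (p⊆q⇒p∩q≡p p⊆q)))
comparable⇒∣p∣⊓∣q∣≡∣p∩q∣ {p = p} {q} (inj₂ q⊆p) = begin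
  ∣ p ∣ ⊓ ∣ q ∣  ≡⟨ ⊓-comm ∣ p ∣ ∣ q ∣ ⟩
  ∣ q ∣ ⊓ ∣ p ∣  ≡⟨ comparable⇒∣p∣⊓∣q∣≡∣p∩q∣ (inj₁ q⊆p) ⟩
  ∣ q ∩ p ∣      ≡⟨ cong ∣_∣ (∩-comm q p) ⟩
  ∣ p ∩ q ∣      ∎

∩-distribʳ-∩ : ∀ {n} (p q r : Subset n) → (p ∩ q) ∩ r ≡ (p ∩ r) ∩ (q ∩ r)
∩-distribʳ-∩ {n} = solve 3 (λ p q r → (p ⊕ q) ⊕ r ⊜ (p ⊕ r) ⊕ (q ⊕ r)) refl
  where open ∩-Solver (∩-idempotentCommutativeMonoid n)

sum-count⊓count≡∣p∩q∣ : ∀ {n k} (κ : Fin n → Fin k) {p q : Subset n} →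
  (∀ t → Comparable (p ∩ colorClass κ t) (q ∩ colorClass κ t)) →
  sum (map (λ t → count κ p t ⊓ count κ q t) (allFin k)) ≡ ∣ p ∩ q ∣
sum-count⊓count≡∣p∩q∣ {k = k} κ {p} {q} comparable = begin
  sum (map (λ t → count κ p t ⊓ count κ q t) (allFin k))  ≡⟨ sum-map-allFin k _ ⟩
  ∑[ t < k ] (count κ p t ⊓ count κ q t)                  ≡⟨ sum-cong-≗ count⊓count≡count∩ ⟩
  ∑[ t < k ] count κ (p ∩ q) t                             ≡⟨ ∑-count≡∣p∣ κ (p ∩ q) ⟩
  ∣ p ∩ q ∣                                                ∎
  where
  count⊓count≡count∩ : ∀ t → count κ p t ⊓ count κ q t ≡ count κ (p ∩ q) t
  count⊓count≡count∩ t = trans (comparable⇒∣p∣⊓∣q∣≡∣p∩q∣ (comparable t))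
                               (cong ∣_∣ (≡.sym (∩-distribʳ-∩ p q (colorClass κ t))))

∈-tabulate⁻ : ∀ {n} (f : Fin n → Bool) {x} → x ∈ Vec.tabulate f → f x ≡ true
∈-tabulate⁻ f {x} x∈ = trans (≡.sym (lookup∘tabulate f x)) ([]=⇒lookup x∈)

∈-tabulate⁺ : ∀ {n} (f : Fin n → Bool) {x} → f x ≡ true → x ∈ Vec.tabulate f
∈-tabulate⁺ f {x} fx≡true = lookup⇒[]= x _ (trans (lookup∘tabulate f x) fx≡true)

∈colorClass⁻ : ∀ {n k} (κ : Fin n → Fin k) {t x} → x ∈ colorClass κ t → κ x ≡ t
∈colorClass⁻ κ x∈ = toWitness (Equivalence.from T-≡ (∈-tabulate⁻ _ x∈))

∈Nbhd-sym : ∀ {n} (G : SimpleGraph n) {v x} → x ∈ Nbhd G v → v ∈ Nbhd G x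
∈Nbhd-sym G {v} {x} x∈Nv = ∈-tabulate⁺ (adj G x) (trans (sym G x v) (∈-tabulate⁻ (adj G v) x∈Nv))

facet≡Nbhd : ∀ {n} (G : SimpleGraph n) {F} → IsFacetN G F → ∃ λ v → F ≡ Nbhd G v
facet≡Nbhd G ((v , F⊆Nv) , maximal) = v , ⊆-antisym F⊆Nv (maximal (Nbhd G v) (v , id) F⊆Nv)

Nbhd∩colorClass-comparable : ∀ {n k} (G : SimpleGraph n) (ν : Fin n → Fin k) →
  (∀ u v → ν u ≡ ν v → Comparable (Nbhd G v) (Nbhd G u)) →
  ∀ v v' t → Comparable (Nbhd G v ∩ colorClass ν t) (Nbhd G v' ∩ colorClass ν t)
Nbhd∩colorClass-comparable G ν nested v v' t = no-crossing⇒comparable no-crossing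
  where
  no-crossing : ∀ {x y} → x ∈ Nbhd G v ∩ colorClass ν t → y ∈ Nbhd G v' ∩ colorClass ν t →
                x ∈ Nbhd G v' ∩ colorClass ν t ⊎ y ∈ Nbhd G v ∩ colorClass ν t
  no-crossing {x} {y} x∈ y∈
    with x∈Nv , x∈C ← x∈p∩q⁻ (Nbhd G v) _ x∈
       | y∈Nv' , y∈C ← x∈p∩q⁻ (Nbhd G v') _ y∈
    with nested x y (trans (∈colorClass⁻ ν x∈C) (≡.sym (∈colorClass⁻ ν y∈C)))
  ... | inj₁ Ny⊆Nx = inj₁ (x∈p∩q⁺ (∈Nbhd-sym G (Ny⊆Nx (∈Nbhd-sym G y∈Nv')) , x∈C))
  ... | inj₂ Nx⊆Ny = inj₂ (x∈p∩q⁺ (∈Nbhd-sym G (Nx⊆Ny (∈Nbhd-sym G x∈Nv)) , y∈C))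

proposition8p4 : ∀ {n k : ℕ} (G : SimpleGraph n) (ν : Fin n → Fin k) →
    IsColoring G ν →
    (∀ u v → ν u ≡ ν v → (Nbhd G v ⊆ Nbhd G u) ⊎ (Nbhd G u ⊆ Nbhd G v)) →
    IsKLinearColoringN k G ν
proposition8p4 {k = k} G ν (surjective , _) nested = surjective , linear
  where
  linear : ∀ F F' → IsFacetN G F → IsFacetN G F' →
           sum (map (λ t → count ν F t ⊓ count ν F' t) (allFin k)) ≡ ∣ F ∩ F' ∣
  linear F F' facet facet' with facet≡Nbhd G facet | facet≡Nbhd G facet'
  ... | v , refl | v' , refl = sum-count⊓count≡∣p∩q∣ ν (Nbhd∩colorClass-comparable G ν nested v v')
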